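{- Let $n$ be a non-negative integer and $j$ an integer with $0\le j\le n$. For $0\le k\le 2n$ put $F(2n,k)=(-1)^k C(2n,k)\,C(2n,2n-k)$, where $C(N,k)=\frac{N-k+1}{N+1}\binom{N+k}{N}$. Define \[ M_S(2n,j,0)=\binom{2n-j}{j}\sum_{v=0}^{2n-2j}\binom{2n-2j}{v}F(2n,j+v). \] Then \[ M_S(2n,j,0)=(-1)^n\cdot C^{(3)}_n\cdot \frac{\binom{2n+j}{j}\binom{2n+1}{n+j+1}}{2n+1}\cdot\bigl(2n^2+n+1-j(n-1)\bigr), \] where $C^{(3)}_n=\frac{1}{2n+1}\binom{3n}{n}$.
   Context: $C(N,k)$ for $0\le k\le N$ is the Catalan triangle entry (number of lattice paths from $(0,0)$ to $(N,k)$ with steps $(1,0),(0,1)$ never rising above $y=x$). $C^{(3)}_n$ is the Fuss--Catalan number of order three. -}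

module Defs where

open import Data.Nat as ℕ using (ℕ; zero; suc; _∸_)
open import Data.Nat.Combinatorics using (_C_)
open import Data.Integer as ℤ using (ℤ; +_)
open import Data.Rational using (ℚ; _/_; _*_; _+_; -_; 0ℚ; 1ℚ)

ℕ→ℚ : ℕ → ℚ
ℕ→ℚ m = + m / 1

binom : ℕ → ℕ → ℚ
binom a b = ℕ→ℚ (a C b)

sgn : ℕ → ℚ
sgn zero = 1ℚ
sgn (suc k) = - sgn k

sumTo : ℕ → (ℕ → ℚ) → ℚ
sumTo zero f = f 0
sumTo (suc m) f = sumTo m f + f (suc m)

-- Catalan triangle C(N,k) = (N-k+1)/(N+1) * binom(N+k, N), used for 0 ≤ k ≤ N
Cat : ℕ → ℕ → ℚ
Cat N k = ((+ (N ∸ k ℕ.+ 1)) / suc N) * binom (N ℕ.+ k) N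

F : ℕ → ℕ → ℚ
F n k = sgn k * Cat (2 ℕ.* n) k * Cat (2 ℕ.* n) (2 ℕ.* n ∸ k)

MS : ℕ → ℕ → ℚ
MS n j = binom (2 ℕ.* n ∸ j) j
       * sumTo (2 ℕ.* n ∸ 2 ℕ.* j) (λ v → binom (2 ℕ.* n ∸ 2 ℕ.* j) v * F n (j ℕ.+ v))

FussCat3 : ℕ → ℚ
FussCat3 n = + ((3 ℕ.* n) C n) / suc (2 ℕ.* n)

RHS : ℕ → ℕ → ℚ
RHS n j = sgn n * FussCat3 n
        * (+ (((2 ℕ.* n ℕ.+ j) C j) ℕ.* ((2 ℕ.* n ℕ.+ 1) C (n ℕ.+ j ℕ.+ 1))) / suc (2 ℕ.* n))
        * (((+ (2 ℕ.* n ℕ.* n ℕ.+ n ℕ.+ 1)) ℤ.- (+ j) ℤ.* ((+ n) ℤ.- + 1)) / 1)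

{-# OPTIONS --safe #-}
-- Downward induction on j, starting at j = n.  By definition MS(2n,j,0) = binom(2n-j,j) S(j) with
-- S(j) = Σ_v binom(2n-2j,v) F(2n,j+v).  Creative telescoping (Zeilberger's algorithm) supplies a
-- certificate R(n,j,v) that turns Q(n,j) S(j+1) - P(n,j) S(j) into a telescoping sum, so S obeys a
-- first-order recurrence in j.  The closed form divided by binom(2n-j,j) obeys the same recurrence:
-- its j-ratio is a ratio of binomial coefficients times L(n,j+1)/L(n,j), where L(n,j) = 2n²+n+1-j(n-1),
-- and L(n,j) divides Q(n,j) while L(n,j+1) divides P(n,j).  At j = n both sides of the theorem equal
-- (-1)ⁿ (n+1)² binom(3n,n)² / (2n+1)².
module Submission where

open import Defs
open import Agda.Builtin.FromNat using (Number; fromNat)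
open import Data.Integer as ℤ using (+_; -[1+_])
import Data.Integer.Properties as ℤP
open import Data.List using (_∷_; [])
open import Data.Maybe using (Maybe; just; nothing)
open import Data.Nat as ℕ using (ℕ; zero; suc; _∸_; _≤_; _<_; z≤n; s≤s)
import Data.Nat.Literals as ℕ-Literals
import Data.Nat.Properties as ℕP
open import Data.Nat.Combinatorics
  using (_C_; nCn≡1; nC1≡n; nCk≡nC[n∸k]; nCk+nC[k+1]≡[n+1]C[k+1]; k>n⇒nCk≡0)
open import Data.Nat.Tactic.RingSolver using () renaming (solve-∀ to solveℕ)
open import Data.Rational as ℚ using (ℚ; _+_; _*_; _-_; -_; 0ℚ; 1ℚ; 1/_)
open import Data.Rational.Literals as ℚ-Literals using (fromℤ)
import Data.Rational.Properties as ℚP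
import Data.Rational.Unnormalised as ℚᵘ
import Data.Rational.Unnormalised.Properties as ℚᵘP
open import Algebra.Properties.Group ℚP.+-0-group using (x∙y⁻¹≈ε⇒x≈y)
open import Data.Unit using (tt)
open import Function using (case_of_)
open import Level using (0ℓ)
open import Relation.Binary.PropositionalEquality hiding (J)
open import Relation.Nullary using (yes; no)
open import Tactic.RingSolver using (solve-∀; solve)
open import Tactic.RingSolver.Core.AlmostCommutativeRing
  using (AlmostCommutativeRing; fromCommutativeRing)

instance
  ℕ-number : Number ℕ
  ℕ-number = ℕ-Literals.number

  ℚ-number : Number ℚ
  ℚ-number = ℚ-Literals.number

ℚ-ring : AlmostCommutativeRing 0ℓ 0ℓ
ℚ-ring = fromCommutativeRing ℚP.+-*-commutativeRing isZero
  where
  isZero : ∀ x → Maybe (0ℚ ≡ x)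
  isZero x with x ℚP.≟ 0ℚ
  ... | yes x≡0 = just (sym x≡0)
  ... | no _    = nothing

open AlmostCommutativeRing ℚ-ring using (_^_)

ℕ→ℚ≡fromℤ : ∀ m → ℕ→ℚ m ≡ fromℤ (+ m)
ℕ→ℚ≡fromℤ m = ℚP.↥p/↧p≡p (fromℤ (+ m))

fromℤ-homo-+ : ∀ x y → fromℤ (x ℤ.+ y) ≡ fromℤ x + fromℤ y
fromℤ-homo-+ x y = sym (trans
  (ℚP./-cong {p₁ = x ℤ.* + 1 ℤ.+ y ℤ.* + 1} {q₁ = 1} {p₂ = x ℤ.+ y} {q₂ = 1}
             (cong₂ ℤ._+_ (ℤP.*-identityʳ x) (ℤP.*-identityʳ y)) refl)
  (ℚP.↥p/↧p≡p (fromℤ (x ℤ.+ y))))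

fromℤ-homo-* : ∀ x y → fromℤ (x ℤ.* y) ≡ fromℤ x * fromℤ y
fromℤ-homo-* x y = sym (ℚP.↥p/↧p≡p (fromℤ (x ℤ.* y)))

fromℤ-homo‿- : ∀ x → fromℤ (ℤ.- x) ≡ - fromℤ x
fromℤ-homo‿- (+ zero)  = refl
fromℤ-homo‿- (+ suc x) = refl
fromℤ-homo‿- -[1+ x ]  = refl

fromℤ-homo-minus : ∀ x y → fromℤ (x ℤ.- y) ≡ fromℤ x - fromℤ y
fromℤ-homo-minus x y = trans (fromℤ-homo-+ x (ℤ.- y)) (cong (λ z → fromℤ x + z) (fromℤ-homo‿- y))

ℕ→ℚ-homo-+ : ∀ a b → ℕ→ℚ (a ℕ.+ b) ≡ ℕ→ℚ a + ℕ→ℚ b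
ℕ→ℚ-homo-+ a b rewrite ℕ→ℚ≡fromℤ (a ℕ.+ b) | ℕ→ℚ≡fromℤ a | ℕ→ℚ≡fromℤ b =
  trans (cong fromℤ (ℤP.pos-+ a b)) (fromℤ-homo-+ (+ a) (+ b))

ℕ→ℚ-homo-* : ∀ a b → ℕ→ℚ (a ℕ.* b) ≡ ℕ→ℚ a * ℕ→ℚ b
ℕ→ℚ-homo-* a b rewrite ℕ→ℚ≡fromℤ (a ℕ.* b) | ℕ→ℚ≡fromℤ a | ℕ→ℚ≡fromℤ b =
  trans (cong fromℤ (ℤP.pos-* a b)) (fromℤ-homo-* (+ a) (+ b))

0<n⇒ℕ→ℚ[n]≢0 : ∀ {n} → 0 < n → ℕ→ℚ n ≢ 0ℚ
0<n⇒ℕ→ℚ[n]≢0 {suc n} _ eq =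
  ℕP.1+n≢0 (ℤP.+-injective (ℚP.p≡0⇒↥p≡0 _ (trans (sym (ℕ→ℚ≡fromℤ (suc n))) eq)))

*-cancelˡ-≢0 : ∀ r {p q} → r ≢ 0ℚ → r * p ≡ r * q → p ≡ q
*-cancelˡ-≢0 r {p} {q} r≢0 rp≡rq = begin
  p                ≡⟨ ℚP.*-identityˡ p ⟨
  1ℚ * p           ≡⟨ cong (_* p) (ℚP.*-inverseˡ r) ⟨
  (1/ r * r) * p   ≡⟨ ℚP.*-assoc (1/ r) r p ⟩
  1/ r * (r * p)   ≡⟨ cong (1/ r *_) rp≡rq ⟩
  1/ r * (r * q)   ≡⟨ ℚP.*-assoc (1/ r) r q ⟨
  (1/ r * r) * q   ≡⟨ cong (_* q) (ℚP.*-inverseˡ r) ⟩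
  1ℚ * q           ≡⟨ ℚP.*-identityˡ q ⟩
  q                ∎
  where
  open ≡-Reasoning
  instance _ = ℚ.≢-nonZero r≢0

inv-suc : ℕ → ℚ
inv-suc N = + 1 ℚ./ suc N

/suc≡*inv-suc : ∀ x N → + x ℚ./ suc N ≡ ℕ→ℚ x * inv-suc N
/suc≡*inv-suc x N rewrite ℕ→ℚ≡fromℤ x = ℚP.toℚᵘ-injective (begin
  ℚ.toℚᵘ (+ x ℚ./ suc N)                         ≈⟨ ℚP.toℚᵘ-fromℚᵘ (ℚᵘ.mkℚᵘ (+ x) N) ⟩
  ℚᵘ.mkℚᵘ (+ x) N                                ≈⟨ ℚᵘ.*≡* (sym (ℤP.*-assoc (+ x) (+ 1) (+ suc N))) ⟩
  ℚᵘ.mkℚᵘ (+ x) 0 ℚᵘ.* ℚᵘ.mkℚᵘ (+ 1) N           ≈⟨ ℚᵘP.*-congˡ {ℚᵘ.mkℚᵘ (+ x) 0}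
                                                               (ℚP.toℚᵘ-fromℚᵘ (ℚᵘ.mkℚᵘ (+ 1) N)) ⟨
  ℚ.toℚᵘ (fromℤ (+ x)) ℚᵘ.* ℚ.toℚᵘ (inv-suc N)   ≈⟨ ℚP.toℚᵘ-homo-* (fromℤ (+ x)) (inv-suc N) ⟨
  ℚ.toℚᵘ (fromℤ (+ x) * inv-suc N)               ∎)
  where open ℚᵘP.≃-Reasoning

-- Polynomial expressions over natural-number atoms, read in ℕ and in ℚ: they carry identities
-- proved in ℕ over to ℚ along ℕ→ℚ.

infixl 6 _:+_
infixl 7 _:*_
infix  8 1+_

data Expr : Set where
  ⌜_⌝  : ℕ → Expr
  1+_  : Expr → Expr
  _:+_ : Expr → Expr → Expr
  _:*_ : Expr → Expr → Expr

⟦_⟧ℕ : Expr → ℕ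
⟦ ⌜ x ⌝  ⟧ℕ = x
⟦ 1+ e   ⟧ℕ = suc ⟦ e ⟧ℕ
⟦ e :+ f ⟧ℕ = ⟦ e ⟧ℕ ℕ.+ ⟦ f ⟧ℕ
⟦ e :* f ⟧ℕ = ⟦ e ⟧ℕ ℕ.* ⟦ f ⟧ℕ

⟦_⟧ℚ : Expr → ℚ
⟦ ⌜ x ⌝  ⟧ℚ = ℕ→ℚ x
⟦ 1+ e   ⟧ℚ = 1 + ⟦ e ⟧ℚ
⟦ e :+ f ⟧ℚ = ⟦ e ⟧ℚ + ⟦ f ⟧ℚ
⟦ e :* f ⟧ℚ = ⟦ e ⟧ℚ * ⟦ f ⟧ℚ

ℕ→ℚ-homo-⟦⟧ : ∀ e → ℕ→ℚ ⟦ e ⟧ℕ ≡ ⟦ e ⟧ℚ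
ℕ→ℚ-homo-⟦⟧ ⌜ x ⌝    = refl
ℕ→ℚ-homo-⟦⟧ (1+ e)   = trans (ℕ→ℚ-homo-+ 1 ⟦ e ⟧ℕ) (cong (λ x → 1 + x) (ℕ→ℚ-homo-⟦⟧ e))
ℕ→ℚ-homo-⟦⟧ (e :+ f) =
  trans (ℕ→ℚ-homo-+ ⟦ e ⟧ℕ ⟦ f ⟧ℕ) (cong₂ _+_ (ℕ→ℚ-homo-⟦⟧ e) (ℕ→ℚ-homo-⟦⟧ f))
ℕ→ℚ-homo-⟦⟧ (e :* f) =
  trans (ℕ→ℚ-homo-* ⟦ e ⟧ℕ ⟦ f ⟧ℕ) (cong₂ _*_ (ℕ→ℚ-homo-⟦⟧ e) (ℕ→ℚ-homo-⟦⟧ f))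

⟦⟧ℕ≡⇒⟦⟧ℚ≡ : ∀ e f → ⟦ e ⟧ℕ ≡ ⟦ f ⟧ℕ → ⟦ e ⟧ℚ ≡ ⟦ f ⟧ℚ
⟦⟧ℕ≡⇒⟦⟧ℚ≡ e f eq = trans (sym (ℕ→ℚ-homo-⟦⟧ e)) (trans (cong ℕ→ℚ eq) (ℕ→ℚ-homo-⟦⟧ f))

ℕ→ℚ-suc : ∀ v → ℕ→ℚ (suc v) ≡ ℕ→ℚ v + 1
ℕ→ℚ-suc v = trans (ℕ→ℚ-homo-⟦⟧ (1+ ⌜ v ⌝)) (ℚP.+-comm 1 (ℕ→ℚ v))

ℕ→ℚ-n*[n∸1] : ∀ w → ℕ→ℚ (w ℕ.* (w ∸ 1)) ≡ ℕ→ℚ w * (ℕ→ℚ w - 1)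
ℕ→ℚ-n*[n∸1] zero    = refl
ℕ→ℚ-n*[n∸1] (suc w) = begin
  ℕ→ℚ (suc w ℕ.* w)                ≡⟨ ℕ→ℚ-homo-⟦⟧ (1+ ⌜ w ⌝ :* ⌜ w ⌝) ⟩
  (1 + ℕ→ℚ w) * ℕ→ℚ w              ≡⟨ add-sub (ℕ→ℚ w) ⟩
  (1 + ℕ→ℚ w) * (1 + ℕ→ℚ w - 1)    ≡⟨ cong (λ z → z * (z - 1)) (ℕ→ℚ-homo-⟦⟧ (1+ ⌜ w ⌝)) ⟨
  ℕ→ℚ (suc w) * (ℕ→ℚ (suc w) - 1)  ∎
  where
  open ≡-Reasoning
  add-sub : ∀ x → (1 + x) * x ≡ (1 + x) * (1 + x - 1)
  add-sub = solve-∀ ℚ-ring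

sumTo-cong : ∀ M {f g : ℕ → ℚ} → (∀ v → v ≤ M → f v ≡ g v) → sumTo M f ≡ sumTo M g
sumTo-cong zero    f≗g = f≗g 0 z≤n
sumTo-cong (suc M) f≗g =
  cong₂ _+_ (sumTo-cong M (λ v v≤M → f≗g v (ℕP.m≤n⇒m≤1+n v≤M))) (f≗g (suc M) ℕP.≤-refl)

sumTo-linear : ∀ M a b (f g : ℕ → ℚ) →
               sumTo M (λ v → a * f v + b * g v) ≡ a * sumTo M f + b * sumTo M g
sumTo-linear zero    a b f g = refl
sumTo-linear (suc M) a b f g =
  trans (cong (_+ (a * f (suc M) + b * g (suc M))) (sumTo-linear M a b f g))
        (regroup a b (sumTo M f) (sumTo M g) (f (suc M)) (g (suc M)))
  where
  regroup : ∀ a b s t x y → (a * s + b * t) + (a * x + b * y) ≡ a * (s + x) + b * (t + y)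
  regroup = solve-∀ ℚ-ring

sumTo-telescoping : ∀ M (G : ℕ → ℚ) → sumTo M (λ v → G (suc v) - G v) ≡ G (suc M) - G 0
sumTo-telescoping zero    G = refl
sumTo-telescoping (suc M) G =
  trans (cong (_+ (G (suc (suc M)) - G (suc M))) (sumTo-telescoping M G))
        (cancel (G (suc (suc M))) (G (suc M)) (G 0))
  where
  cancel : ∀ x y z → (y - z) + (x - y) ≡ x - z
  cancel = solve-∀ ℚ-ring

sumTo-vanishing-tail : ∀ k M (f : ℕ → ℚ) → (∀ v → M < v → f v ≡ 0ℚ) → sumTo (k ℕ.+ M) f ≡ sumTo M f
sumTo-vanishing-tail zero    M f f≡0 = refl
sumTo-vanishing-tail (suc k) M f f≡0 = begin
  sumTo (k ℕ.+ M) f + f (suc (k ℕ.+ M))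
    ≡⟨ cong₂ _+_ (sumTo-vanishing-tail k M f f≡0) (f≡0 _ (s≤s (ℕP.m≤n+m M k))) ⟩
  sumTo M f + 0ℚ
    ≡⟨ ℚP.+-identityʳ (sumTo M f) ⟩
  sumTo M f
    ∎
  where open ≡-Reasoning

nC0≡1 : ∀ n → n C 0 ≡ 1
nC0≡1 n = trans (nCk≡nC[n∸k] {0} {n} z≤n) (nCn≡1 n)

k≤n⇒0<nCk : ∀ {n k} → k ≤ n → 0 < n C k
k≤n⇒0<nCk {n}     {zero}  _         = subst (0 <_) (sym (nC0≡1 n)) (s≤s z≤n)
k≤n⇒0<nCk {suc n} {suc k} (s≤s k≤n) = subst (0 <_) (nCk+nC[k+1]≡[n+1]C[k+1] n k)
  (ℕP.<-≤-trans (k≤n⇒0<nCk k≤n) (ℕP.m≤m+n (n C k) (n C suc k)))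

m>0∧n>0⇒m*n>0 : ∀ {m n} → 0 < m → 0 < n → 0 < m ℕ.* n
m>0∧n>0⇒m*n>0 {suc m} {suc n} _ _ = s≤s z≤n

[k+1]*[n+1]C[k+1]≡[n+1]*nCk : ∀ n k → suc k ℕ.* (suc n C suc k) ≡ suc n ℕ.* (n C k)
[k+1]*[n+1]C[k+1]≡[n+1]*nCk n zero = begin
  1 ℕ.* (suc n C 1)  ≡⟨ ℕP.*-identityˡ _ ⟩
  suc n C 1          ≡⟨ nC1≡n (suc n) ⟩
  suc n              ≡⟨ ℕP.*-identityʳ (suc n) ⟨
  suc n ℕ.* 1        ≡⟨ cong (suc n ℕ.*_) (nC0≡1 n) ⟨
  suc n ℕ.* (n C 0)  ∎
  where open ≡-Reasoning
[k+1]*[n+1]C[k+1]≡[n+1]*nCk zero (suc k) = begin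
  suc (suc k) ℕ.* (1 C suc (suc k))  ≡⟨ cong (suc (suc k) ℕ.*_) (k>n⇒nCk≡0 {1} {suc (suc k)} (s≤s (s≤s z≤n))) ⟩
  suc (suc k) ℕ.* 0                  ≡⟨ ℕP.*-zeroʳ (suc (suc k)) ⟩
  0                                  ≡⟨ cong (1 ℕ.*_) (k>n⇒nCk≡0 {0} {suc k} (s≤s z≤n)) ⟨
  1 ℕ.* (0 C suc k)                  ∎
  where open ≡-Reasoning
[k+1]*[n+1]C[k+1]≡[n+1]*nCk (suc n) (suc k) = begin
  suc (suc k) ℕ.* (suc (suc n) C suc (suc k))
    ≡⟨ cong (suc (suc k) ℕ.*_) (nCk+nC[k+1]≡[n+1]C[k+1] (suc n) (suc k)) ⟨
  suc (suc k) ℕ.* (a ℕ.+ b)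
    ≡⟨ split k a b ⟩
  a ℕ.+ (suc k ℕ.* a ℕ.+ suc (suc k) ℕ.* b)
    ≡⟨ cong₂ (λ x y → a ℕ.+ (x ℕ.+ y)) ([k+1]*[n+1]C[k+1]≡[n+1]*nCk n k)
                                         ([k+1]*[n+1]C[k+1]≡[n+1]*nCk n (suc k)) ⟩
  a ℕ.+ (suc n ℕ.* (n C k) ℕ.+ suc n ℕ.* (n C suc k))
    ≡⟨ cong (a ℕ.+_) (ℕP.*-distribˡ-+ (suc n) (n C k) (n C suc k)) ⟨
  a ℕ.+ suc n ℕ.* (n C k ℕ.+ n C suc k)
    ≡⟨ cong (λ x → a ℕ.+ suc n ℕ.* x) (nCk+nC[k+1]≡[n+1]C[k+1] n k) ⟩
  suc (suc n) ℕ.* a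
    ∎
  where
  open ≡-Reasoning
  a b : ℕ
  a = suc n C suc k
  b = suc n C suc (suc k)
  split : ∀ k a b → suc (suc k) ℕ.* (a ℕ.+ b) ≡ a ℕ.+ (suc k ℕ.* a ℕ.+ suc (suc k) ℕ.* b)
  split = solveℕ

[k+1]*[k+l]C[k+1]≡l*[k+l]Ck : ∀ k l → suc k ℕ.* ((k ℕ.+ l) C suc k) ≡ l ℕ.* ((k ℕ.+ l) C k)
[k+1]*[k+l]C[k+1]≡l*[k+l]Ck k l = ℕP.+-cancelˡ-≡ (suc k ℕ.* c₀) _ _ (begin
  suc k ℕ.* c₀ ℕ.+ suc k ℕ.* c₁      ≡⟨ ℕP.*-distribˡ-+ (suc k) c₀ c₁ ⟨
  suc k ℕ.* (c₀ ℕ.+ c₁)              ≡⟨ cong (suc k ℕ.*_) (nCk+nC[k+1]≡[n+1]C[k+1] (k ℕ.+ l) k) ⟩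
  suc k ℕ.* (suc (k ℕ.+ l) C suc k)  ≡⟨ [k+1]*[n+1]C[k+1]≡[n+1]*nCk (k ℕ.+ l) k ⟩
  suc (k ℕ.+ l) ℕ.* c₀               ≡⟨ split k l c₀ ⟩
  suc k ℕ.* c₀ ℕ.+ l ℕ.* c₀          ∎)
  where
  open ≡-Reasoning
  c₀ c₁ : ℕ
  c₀ = (k ℕ.+ l) C k
  c₁ = (k ℕ.+ l) C suc k
  split : ∀ k l c → suc (k ℕ.+ l) ℕ.* c ≡ suc k ℕ.* c ℕ.+ l ℕ.* c
  split = solveℕ

[l+1]*[k+l+1]Ck≡[k+l+1]*[k+l]Ck : ∀ k l → suc l ℕ.* (suc (k ℕ.+ l) C k) ≡ suc (k ℕ.+ l) ℕ.* ((k ℕ.+ l) C k)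
[l+1]*[k+l+1]Ck≡[k+l+1]*[k+l]Ck k l = begin
  suc l ℕ.* (suc (k ℕ.+ l) C k)      ≡⟨ cong (λ x → suc l ℕ.* (x C k)) (ℕP.+-suc k l) ⟨
  suc l ℕ.* ((k ℕ.+ suc l) C k)      ≡⟨ [k+1]*[k+l]C[k+1]≡l*[k+l]Ck k (suc l) ⟨
  suc k ℕ.* ((k ℕ.+ suc l) C suc k)  ≡⟨ cong (λ x → suc k ℕ.* (x C suc k)) (ℕP.+-suc k l) ⟩
  suc k ℕ.* (suc (k ℕ.+ l) C suc k)  ≡⟨ [k+1]*[n+1]C[k+1]≡[n+1]*nCk (k ℕ.+ l) k ⟩
  suc (k ℕ.+ l) ℕ.* ((k ℕ.+ l) C k)  ∎
  where open ≡-Reasoning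

[k+l+2][k+l+1]*[k+l]Ck≡[l+2][l+1]*[k+l+2]Ck : ∀ k l →
  suc (suc (k ℕ.+ l)) ℕ.* suc (k ℕ.+ l) ℕ.* ((k ℕ.+ l) C k) ≡ suc (suc l) ℕ.* suc l ℕ.* (suc (suc (k ℕ.+ l)) C k)
[k+l+2][k+l+1]*[k+l]Ck≡[l+2][l+1]*[k+l+2]Ck k l = begin
  suc (suc s) ℕ.* suc s ℕ.* c₀    ≡⟨ ℕP.*-assoc (suc (suc s)) (suc s) c₀ ⟩
  suc (suc s) ℕ.* (suc s ℕ.* c₀)  ≡⟨ cong (suc (suc s) ℕ.*_) ([l+1]*[k+l+1]Ck≡[k+l+1]*[k+l]Ck k l) ⟨
  suc (suc s) ℕ.* (suc l ℕ.* c₁)  ≡⟨ swap (suc (suc s)) (suc l) c₁ ⟩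
  suc l ℕ.* (suc (suc s) ℕ.* c₁)  ≡⟨ cong (suc l ℕ.*_) shift ⟨
  suc l ℕ.* (suc (suc l) ℕ.* c₂)  ≡⟨ swap (suc l) (suc (suc l)) c₂ ⟩
  suc (suc l) ℕ.* (suc l ℕ.* c₂)  ≡⟨ ℕP.*-assoc (suc (suc l)) (suc l) c₂ ⟨
  suc (suc l) ℕ.* suc l ℕ.* c₂    ∎
  where
  open ≡-Reasoning
  s c₀ c₁ c₂ : ℕ
  s  = k ℕ.+ l
  c₀ = s C k
  c₁ = suc s C k
  c₂ = suc (suc s) C k
  shift : suc (suc l) ℕ.* c₂ ≡ suc (suc s) ℕ.* c₁
  shift = subst (λ x → suc (suc l) ℕ.* (suc x C k) ≡ suc x ℕ.* (x C k)) (ℕP.+-suc k l)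
                ([l+1]*[k+l+1]Ck≡[k+l+1]*[k+l]Ck k (suc l))
  swap : ∀ x y z → x ℕ.* (y ℕ.* z) ≡ y ℕ.* (x ℕ.* z)
  swap = solveℕ

v+[2+w]≡2+M⇒M≡v+w : ∀ {v w M} → v ℕ.+ suc (suc w) ≡ suc (suc M) → M ≡ v ℕ.+ w
v+[2+w]≡2+M⇒M≡v+w {v} {w} h =
  ℕP.suc-injective (ℕP.suc-injective (trans (sym h) (trans (ℕP.+-suc v (suc w)) (cong suc (ℕP.+-suc v w)))))

Fbin : ℕ → ℕ → ℕ
Fbin N k = ((N ℕ.+ k) C N) ℕ.* ((N ℕ.+ (N ∸ k)) C N)

Fnum : ℕ → ℕ → ℕ
Fnum N k = (N ∸ k ℕ.+ 1) ℕ.* (k ℕ.+ 1) ℕ.* Fbin N k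

Cat≡ : ∀ N k → Cat N k ≡ ℕ→ℚ (N ∸ k ℕ.+ 1) * inv-suc N * binom (N ℕ.+ k) N
Cat≡ N k = cong (_* binom (N ℕ.+ k) N) (/suc≡*inv-suc (N ∸ k ℕ.+ 1) N)

F≡sgn*Fnum : ∀ n k → k ≤ 2 ℕ.* n →
             F n k ≡ sgn k * (inv-suc (2 ℕ.* n) * inv-suc (2 ℕ.* n)) * ℕ→ℚ (Fnum (2 ℕ.* n) k)
F≡sgn*Fnum n k k≤N = begin
  sgn k * Cat N k * Cat N (N ∸ k)
    ≡⟨ cong₂ (λ x y → sgn k * x * y) (Cat≡ N k) (Cat≡ N (N ∸ k)) ⟩
  sgn k * (ℕ→ℚ (N ∸ k ℕ.+ 1) * K * B₁) * (ℕ→ℚ (N ∸ (N ∸ k) ℕ.+ 1) * K * B₂)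
    ≡⟨ cong (λ x → sgn k * (ℕ→ℚ (N ∸ k ℕ.+ 1) * K * B₁) * (ℕ→ℚ (x ℕ.+ 1) * K * B₂))
            (ℕP.m∸[m∸n]≡n k≤N) ⟩
  sgn k * (ℕ→ℚ (N ∸ k ℕ.+ 1) * K * B₁) * (ℕ→ℚ (k ℕ.+ 1) * K * B₂)
    ≡⟨ regroup (sgn k) K (ℕ→ℚ (N ∸ k ℕ.+ 1)) (ℕ→ℚ (k ℕ.+ 1)) B₁ B₂ ⟩
  sgn k * (K * K) * (ℕ→ℚ (N ∸ k ℕ.+ 1) * ℕ→ℚ (k ℕ.+ 1) * (B₁ * B₂))
    ≡⟨ cong (sgn k * (K * K) *_)
            (ℕ→ℚ-homo-⟦⟧ (⌜ N ∸ k ℕ.+ 1 ⌝ :* ⌜ k ℕ.+ 1 ⌝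
                          :* (⌜ (N ℕ.+ k) C N ⌝ :* ⌜ (N ℕ.+ (N ∸ k)) C N ⌝))) ⟨
  sgn k * (K * K) * ℕ→ℚ (Fnum N k)
    ∎
  where
  open ≡-Reasoning
  N : ℕ
  N  = 2 ℕ.* n
  K B₁ B₂ : ℚ
  K  = inv-suc N
  B₁ = binom (N ℕ.+ k) N
  B₂ = binom (N ℕ.+ (N ∸ k)) N
  regroup : ∀ s K a b x y → s * (a * K * x) * (b * K * y) ≡ s * (K * K) * (a * b * (x * y))
  regroup = solve-∀ ℚ-ring

binom*F≡sgn*Fnum : ∀ n M v k → (v ≤ M → k ≤ 2 ℕ.* n) →
  binom M v * F n k ≡ sgn k * (inv-suc (2 ℕ.* n) * inv-suc (2 ℕ.* n)) * ℕ→ℚ ((M C v) ℕ.* Fnum (2 ℕ.* n) k)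
binom*F≡sgn*Fnum n M v k v≤M⇒k≤N = case v ℕP.≤? M of λ where
    (yes v≤M) → begin
      binom M v * F n k                 ≡⟨ cong (binom M v *_) (F≡sgn*Fnum n k (v≤M⇒k≤N v≤M)) ⟩
      binom M v * (c * ℕ→ℚ (Fnum N k))  ≡⟨ swap (binom M v) c (ℕ→ℚ (Fnum N k)) ⟩
      c * (binom M v * ℕ→ℚ (Fnum N k))  ≡⟨ cong (c *_) (ℕ→ℚ-homo-* (M C v) (Fnum N k)) ⟨
      c * ℕ→ℚ ((M C v) ℕ.* Fnum N k)    ∎
    (no v≰M) → let MCv≡0 = k>n⇒nCk≡0 (ℕP.≰⇒> v≰M) in begin
      binom M v * F n k                 ≡⟨ cong (λ x → ℕ→ℚ x * F n k) MCv≡0 ⟩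
      0ℚ * F n k                        ≡⟨ ℚP.*-zeroˡ (F n k) ⟩
      0ℚ                                ≡⟨ ℚP.*-zeroʳ c ⟨
      c * 0ℚ                            ≡⟨ cong (λ x → c * ℕ→ℚ (x ℕ.* Fnum N k)) MCv≡0 ⟨
      c * ℕ→ℚ ((M C v) ℕ.* Fnum N k)    ∎
  where
  open ≡-Reasoning
  N : ℕ
  N = 2 ℕ.* n
  c : ℚ
  c = sgn k * (inv-suc N * inv-suc N)
  swap : ∀ x y z → x * (y * z) ≡ y * (x * z)
  swap = solve-∀ ℚ-ring

Fbin-split : ∀ {N k l} → k ℕ.+ l ≡ N → Fbin N k ≡ ((N ℕ.+ k) C N) ℕ.* ((N ℕ.+ l) C N)
Fbin-split {k = k} {l} refl =
  cong (λ x → ((k ℕ.+ l ℕ.+ k) C (k ℕ.+ l)) ℕ.* ((k ℕ.+ l ℕ.+ x) C (k ℕ.+ l))) (ℕP.m+n∸m≡n k l)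

Fnum-split : ∀ {N k l} → k ℕ.+ l ≡ N → Fnum N k ≡ (l ℕ.+ 1) ℕ.* (k ℕ.+ 1) ℕ.* Fbin N k
Fnum-split {k = k} {l} refl = cong (λ x → (x ℕ.+ 1) ℕ.* (k ℕ.+ 1) ℕ.* Fbin (k ℕ.+ l) k) (ℕP.m+n∸m≡n k l)

Fbin-step : ∀ {N k l} → k ℕ.+ suc l ≡ N →
            suc k ℕ.* suc (N ℕ.+ l) ℕ.* Fbin N (suc k) ≡ suc (N ℕ.+ k) ℕ.* suc l ℕ.* Fbin N k
Fbin-step {N} {k} {l} k+[l+1]≡N = begin
  suc k ℕ.* suc (N ℕ.+ l) ℕ.* Fbin N (suc k)  ≡⟨ cong (suc k ℕ.* suc (N ℕ.+ l) ℕ.*_) split₁ ⟩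
  suc k ℕ.* suc (N ℕ.+ l) ℕ.* (A₁ ℕ.* B)      ≡⟨ interchange (suc k) (suc (N ℕ.+ l)) A₁ B ⟩
  (suc k ℕ.* A₁) ℕ.* (suc (N ℕ.+ l) ℕ.* B)    ≡⟨ cong₂ ℕ._*_ ([l+1]*[k+l+1]Ck≡[k+l+1]*[k+l]Ck N k)
                                                             (sym ([l+1]*[k+l+1]Ck≡[k+l+1]*[k+l]Ck N l)) ⟩
  (suc (N ℕ.+ k) ℕ.* A) ℕ.* (suc l ℕ.* B₁)    ≡⟨ interchange (suc (N ℕ.+ k)) (suc l) A B₁ ⟨
  suc (N ℕ.+ k) ℕ.* suc l ℕ.* (A ℕ.* B₁)      ≡⟨ cong (suc (N ℕ.+ k) ℕ.* suc l ℕ.*_) split₀ ⟨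
  suc (N ℕ.+ k) ℕ.* suc l ℕ.* Fbin N k        ∎
  where
  open ≡-Reasoning
  A A₁ B B₁ : ℕ
  A  = (N ℕ.+ k) C N
  A₁ = suc (N ℕ.+ k) C N
  B  = (N ℕ.+ l) C N
  B₁ = suc (N ℕ.+ l) C N
  split₁ : Fbin N (suc k) ≡ A₁ ℕ.* B
  split₁ = trans (Fbin-split (trans (sym (ℕP.+-suc k l)) k+[l+1]≡N)) (cong (λ z → (z C N) ℕ.* B) (ℕP.+-suc N k))
  split₀ : Fbin N k ≡ A ℕ.* B₁
  split₀ = trans (Fbin-split k+[l+1]≡N) (cong (λ z → A ℕ.* (z C N)) (ℕP.+-suc N l))
  interchange : ∀ a b c d → a ℕ.* b ℕ.* (c ℕ.* d) ≡ (a ℕ.* c) ℕ.* (b ℕ.* d)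
  interchange = solveℕ

kernel : ℕ → ℕ → ℕ → ℕ → ℕ
kernel N M j v = (M C v) ℕ.* Fbin N (j ℕ.+ v)

kernel-Fnum : ∀ {N M j v w} → (j ℕ.+ v) ℕ.+ (j ℕ.+ w) ≡ N →
  (M C v) ℕ.* Fnum N (j ℕ.+ v) ≡ (j ℕ.+ w ℕ.+ 1) ℕ.* (j ℕ.+ v ℕ.+ 1) ℕ.* kernel N M j v
kernel-Fnum {N} {M} {j} {v} {w} eq =
  trans (cong ((M C v) ℕ.*_) (Fnum-split {N} {j ℕ.+ v} {j ℕ.+ w} eq))
        (regroup (M C v) (j ℕ.+ w ℕ.+ 1) (j ℕ.+ v ℕ.+ 1) (Fbin N (j ℕ.+ v)))
  where
  regroup : ∀ c a b f → c ℕ.* (a ℕ.* b ℕ.* f) ≡ a ℕ.* b ℕ.* (c ℕ.* f)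
  regroup = solveℕ

kernel-shift : ∀ {N M j v w} → v ℕ.+ w ≡ M → (j ℕ.+ v) ℕ.+ (j ℕ.+ w) ≡ N →
  (v ℕ.+ 1) ℕ.* (j ℕ.+ v ℕ.+ 1) ℕ.* (N ℕ.+ (j ℕ.+ w)) ℕ.* kernel N M j (suc v)
    ≡ w ℕ.* (N ℕ.+ (j ℕ.+ v) ℕ.+ 1) ℕ.* (j ℕ.+ w) ℕ.* kernel N M j v
kernel-shift {N} {j = j} {v} {zero} refl _ rewrite k>n⇒nCk≡0 (s≤s (ℕP.≤-reflexive (ℕP.+-identityʳ v))) =
  ℕP.*-zeroʳ ((v ℕ.+ 1) ℕ.* (j ℕ.+ v ℕ.+ 1) ℕ.* (N ℕ.+ (j ℕ.+ 0)))
kernel-shift {N} {j = j} {v} {suc w} refl eq = begin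
  (v ℕ.+ 1) ℕ.* (k ℕ.+ 1) ℕ.* (N ℕ.+ (j ℕ.+ suc w)) ℕ.* ((M C suc v) ℕ.* Fbin N (j ℕ.+ suc v))
    ≡⟨ cong₂ (λ a b → (v ℕ.+ 1) ℕ.* (k ℕ.+ 1) ℕ.* a ℕ.* ((M C suc v) ℕ.* Fbin N b))
             (trans (cong (N ℕ.+_) (ℕP.+-suc j w)) (ℕP.+-suc N l)) (ℕP.+-suc j v) ⟩
  (v ℕ.+ 1) ℕ.* (k ℕ.+ 1) ℕ.* suc (N ℕ.+ l) ℕ.* ((M C suc v) ℕ.* Fbin N (suc k))
    ≡⟨ regroup₁ v k (N ℕ.+ l) (M C suc v) (Fbin N (suc k)) ⟩
  (suc v ℕ.* (M C suc v)) ℕ.* (suc k ℕ.* suc (N ℕ.+ l) ℕ.* Fbin N (suc k))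
    ≡⟨ cong₂ ℕ._*_ ([k+1]*[k+l]C[k+1]≡l*[k+l]Ck v (suc w))
                   (Fbin-step (trans (cong (k ℕ.+_) (sym (ℕP.+-suc j w))) eq)) ⟩
  (suc w ℕ.* (M C v)) ℕ.* (suc (N ℕ.+ k) ℕ.* suc l ℕ.* Fbin N k)
    ≡⟨ regroup₂ w (N ℕ.+ k) l (M C v) (Fbin N k) ⟩
  suc w ℕ.* (N ℕ.+ k ℕ.+ 1) ℕ.* suc l ℕ.* kernel N M j v
    ≡⟨ cong (λ a → suc w ℕ.* (N ℕ.+ k ℕ.+ 1) ℕ.* a ℕ.* kernel N M j v) (ℕP.+-suc j w) ⟨
  suc w ℕ.* (N ℕ.+ k ℕ.+ 1) ℕ.* (j ℕ.+ suc w) ℕ.* kernel N M j v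
    ∎
  where
  open ≡-Reasoning
  M k l : ℕ
  M = v ℕ.+ suc w
  k = j ℕ.+ v
  l = j ℕ.+ w
  regroup₁ : ∀ v k s c f → (v ℕ.+ 1) ℕ.* (k ℕ.+ 1) ℕ.* suc s ℕ.* (c ℕ.* f)
                           ≡ (suc v ℕ.* c) ℕ.* (suc k ℕ.* suc s ℕ.* f)
  regroup₁ = solveℕ
  regroup₂ : ∀ w s l c f → (suc w ℕ.* c) ℕ.* (suc s ℕ.* suc l ℕ.* f)
                           ≡ suc w ℕ.* (s ℕ.+ 1) ℕ.* suc l ℕ.* (c ℕ.* f)
  regroup₂ = solveℕ

-- The falling factorial w * (w ∸ 1) vanishes for w ≤ 1, exactly when v > M₂ makes M₂ C v vanish.
kernel-lower : ∀ {N M₂ j v w} → v ℕ.+ w ≡ suc (suc M₂) → (j ℕ.+ v) ℕ.+ (j ℕ.+ w) ≡ N →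
  suc (suc M₂) ℕ.* suc M₂ ℕ.* (j ℕ.+ v ℕ.+ 1) ℕ.* (N ℕ.+ (j ℕ.+ w)) ℕ.* ((M₂ C v) ℕ.* Fnum N (suc (j ℕ.+ v)))
    ≡ (j ℕ.+ w) ℕ.* (j ℕ.+ v ℕ.+ 2) ℕ.* (w ℕ.* (w ∸ 1)) ℕ.* ((N ℕ.+ (j ℕ.+ v) ℕ.+ 1) ℕ.* (j ℕ.+ w))
        ℕ.* kernel N (suc (suc M₂)) j v
kernel-lower {N} {M₂} {j} {v} {zero} v+0≡2+M₂ _
  rewrite k>n⇒nCk≡0 {M₂} {v} (ℕP.≤-trans (ℕP.n≤1+n (suc M₂)) (ℕP.≤-reflexive (sym (trans (sym (ℕP.+-identityʳ v)) v+0≡2+M₂)))) =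
  trans (ℕP.*-zeroʳ (suc (suc M₂) ℕ.* suc M₂ ℕ.* (j ℕ.+ v ℕ.+ 1) ℕ.* (N ℕ.+ (j ℕ.+ 0))))
        (sym (vanish (j ℕ.+ 0) (j ℕ.+ v ℕ.+ 2) ((N ℕ.+ (j ℕ.+ v) ℕ.+ 1) ℕ.* (j ℕ.+ 0)) (kernel N (suc (suc M₂)) j v)))
  where
  vanish : ∀ a b c x → a ℕ.* b ℕ.* 0 ℕ.* c ℕ.* x ≡ 0
  vanish = solveℕ
kernel-lower {N} {M₂} {j} {v} {suc zero} v+1≡2+M₂ _
  rewrite k>n⇒nCk≡0 {M₂} {v} (ℕP.≤-reflexive (sym (ℕP.suc-injective (trans (ℕP.+-comm 1 v) v+1≡2+M₂)))) =
  trans (ℕP.*-zeroʳ (suc (suc M₂) ℕ.* suc M₂ ℕ.* (j ℕ.+ v ℕ.+ 1) ℕ.* (N ℕ.+ (j ℕ.+ 1))))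
        (sym (vanish (j ℕ.+ 1) (j ℕ.+ v ℕ.+ 2) ((N ℕ.+ (j ℕ.+ v) ℕ.+ 1) ℕ.* (j ℕ.+ 1)) (kernel N (suc (suc M₂)) j v)))
  where
  vanish : ∀ a b c x → a ℕ.* b ℕ.* 0 ℕ.* c ℕ.* x ≡ 0
  vanish = solveℕ
kernel-lower {N} {M₂} {j} {v} {suc (suc w)} h eq rewrite v+[2+w]≡2+M⇒M≡v+w h = begin
  μ ℕ.* (k ℕ.+ 1) ℕ.* (N ℕ.+ (j ℕ.+ suc (suc w))) ℕ.* (c ℕ.* Fnum N (suc k))
    ≡⟨ cong₂ (λ a b → μ ℕ.* (k ℕ.+ 1) ℕ.* a ℕ.* (c ℕ.* b))
             (trans (cong (N ℕ.+_) (ℕP.+-suc j (suc w))) (ℕP.+-suc N l))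
             (Fnum-split {N} {suc k} {l} (trans (sym (ℕP.+-suc k l)) k+[l+1]≡N)) ⟩
  μ ℕ.* (k ℕ.+ 1) ℕ.* suc (N ℕ.+ l) ℕ.* (c ℕ.* ((l ℕ.+ 1) ℕ.* (suc k ℕ.+ 1) ℕ.* Fbin N (suc k)))
    ≡⟨ regroup₁ μ k (N ℕ.+ l) c l (Fbin N (suc k)) ⟩
  (μ ℕ.* c) ℕ.* ((l ℕ.+ 1) ℕ.* (k ℕ.+ 2)) ℕ.* (suc k ℕ.* suc (N ℕ.+ l) ℕ.* Fbin N (suc k))
    ≡⟨ cong₂ (λ a b → a ℕ.* ((l ℕ.+ 1) ℕ.* (k ℕ.+ 2)) ℕ.* b)
             ([k+l+2][k+l+1]*[k+l]Ck≡[l+2][l+1]*[k+l+2]Ck v w) (Fbin-step {N} {k} {l} k+[l+1]≡N) ⟩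
  (suc (suc w) ℕ.* suc w ℕ.* (M C v)) ℕ.* ((l ℕ.+ 1) ℕ.* (k ℕ.+ 2)) ℕ.* (suc (N ℕ.+ k) ℕ.* suc l ℕ.* Fbin N k)
    ≡⟨ regroup₂ w (M C v) l k (N ℕ.+ k) (Fbin N k) ⟩
  suc l ℕ.* (k ℕ.+ 2) ℕ.* (suc (suc w) ℕ.* suc w) ℕ.* ((N ℕ.+ k ℕ.+ 1) ℕ.* suc l) ℕ.* kernel N M j v
    ≡⟨ cong (λ a → a ℕ.* (k ℕ.+ 2) ℕ.* (suc (suc w) ℕ.* suc w) ℕ.* ((N ℕ.+ k ℕ.+ 1) ℕ.* a) ℕ.* kernel N M j v)
            (ℕP.+-suc j (suc w)) ⟨
  (j ℕ.+ suc (suc w)) ℕ.* (k ℕ.+ 2) ℕ.* (suc (suc w) ℕ.* suc w) ℕ.* ((N ℕ.+ k ℕ.+ 1) ℕ.* (j ℕ.+ suc (suc w)))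
    ℕ.* kernel N M j v
    ∎
  where
  open ≡-Reasoning
  M μ c k l : ℕ
  M = suc (suc (v ℕ.+ w))
  μ = M ℕ.* suc (v ℕ.+ w)
  c = (v ℕ.+ w) C v
  k = j ℕ.+ v
  l = j ℕ.+ suc w
  k+[l+1]≡N : k ℕ.+ suc l ≡ N
  k+[l+1]≡N = trans (cong (k ℕ.+_) (sym (ℕP.+-suc j (suc w)))) eq
  regroup₁ : ∀ μ k s c l f → μ ℕ.* (k ℕ.+ 1) ℕ.* suc s ℕ.* (c ℕ.* ((l ℕ.+ 1) ℕ.* (suc k ℕ.+ 1) ℕ.* f))
                             ≡ (μ ℕ.* c) ℕ.* ((l ℕ.+ 1) ℕ.* (k ℕ.+ 2)) ℕ.* (suc k ℕ.* suc s ℕ.* f)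
  regroup₁ = solveℕ
  regroup₂ : ∀ w c l k s f → (suc (suc w) ℕ.* suc w ℕ.* c) ℕ.* ((l ℕ.+ 1) ℕ.* (k ℕ.+ 2)) ℕ.* (suc s ℕ.* suc l ℕ.* f)
                             ≡ suc l ℕ.* (k ℕ.+ 2) ℕ.* (suc (suc w) ℕ.* suc w) ℕ.* ((s ℕ.+ 1) ℕ.* suc l) ℕ.* (c ℕ.* f)
  regroup₂ = solveℕ

-- The certificate

-- INLINE lets the reflective ring solver see through these polynomials.

L : ℚ → ℚ → ℚ
L n j = 2 * n ^ 2 + n + 1 - j * (n - 1)
{-# INLINE L #-}

Q : ℚ → ℚ → ℚ
Q n j = 2 * (n + j + 2) * (2 * n - 2 * j - 1) * L n j
{-# INLINE Q #-}

P : ℚ → ℚ → ℚ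
P n j = (2 * n + j + 1) * (2 * n - j) * L n (j + 1)
{-# INLINE P #-}

-- Zeilberger's certificate: with m = 2n - 2j and x = kernel (2n) m j, the sequence
-- G(v) = R(n,j,v) (-1)^(j+v) x(v) / (2n+1)² satisfies m (Q t₁(v) - P t₀(v)) = G(v+1) - G(v),
-- where t₀ and t₁ are the summands of S(j) and S(j+1).
R : ℚ → ℚ → ℚ → ℚ
R n j v =
  let r₁ = 16 * n ^ 5 * j - 32 * n ^ 3 * j ^ 3 + 24 * n ^ 2 * j ^ 4 - 5 * n * j ^ 5 + 16 * n ^ 5
           + 32 * n ^ 4 * j - 56 * n ^ 3 * j ^ 2 + 28 * n ^ 2 * j ^ 3 - 15 * n * j ^ 4 + 5 * j ^ 5
           + 48 * n ^ 4 - 20 * n ^ 3 * j + 12 * n ^ 2 * j ^ 2 - 33 * n * j ^ 3 + 11 * j ^ 4 + 44 * n ^ 3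
           + 4 * n ^ 2 * j - 29 * n * j ^ 2 + j ^ 3 + 28 * n ^ 2 - 6 * n * j - 11 * j ^ 2 + 8 * n - 6 * j
      r₂ = 16 * n ^ 5 - 60 * n ^ 3 * j ^ 2 + 56 * n ^ 2 * j ^ 3 - 14 * n * j ^ 4 + 32 * n ^ 4
           - 64 * n ^ 3 * j + 36 * n ^ 2 * j ^ 2 - 28 * n * j ^ 3 + 14 * j ^ 4 + 2 * n ^ 2 * j
           - 50 * n * j ^ 2 + 28 * j ^ 3 + 2 * n ^ 2 - 32 * n * j + 10 * j ^ 2 - 4 * n - 6 * j - 2
      r₃ = - 36 * n ^ 3 * j + 46 * n ^ 2 * j ^ 2 - 14 * n * j ^ 3 - 20 * n ^ 3 + 12 * n ^ 2 * j
           - 14 * n * j ^ 2 + 14 * j ^ 3 - 8 * n ^ 2 - 21 * n * j + 24 * j ^ 2 - 11 * n + 9 * j - 1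
      r₄ = - 8 * n ^ 3 + 16 * n ^ 2 * j - 6 * n * j ^ 2 + 6 * j ^ 2 - 2 * n + 8 * j + 2
      r₅ = 2 * n ^ 2 - n * j + n + j + 1
  in v * (r₁ + r₂ * v + r₃ * v ^ 2 + r₄ * v ^ 3 + r₅ * v ^ 4)
{-# INLINE R #-}

R[n,j,0]≡0 : ∀ n j → R n j 0 ≡ 0
R[n,j,0]≡0 = solve-∀ ℚ-ring

ratio-num : ℚ → ℚ → ℚ → ℚ → ℚ
ratio-num N j v w = w * (N + (j + v) + 1) * (j + w)
{-# INLINE ratio-num #-}

ratio-den : ℚ → ℚ → ℚ → ℚ → ℚ
ratio-den N j v w = (v + 1) * (j + v + 1) * (N + (j + w))
{-# INLINE ratio-den #-}

-- The telescoping relation divided by the common factor m (-1)^(j+v) x(v) / (2n+1)², with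
-- denominators cleared; N = 2n and w = m - v.
Certificate : (q p r₀ r₁ N m j v w : ℚ) → Set
Certificate q p r₀ r₁ N m j v w =
  q * (v + 1) * (j + w) * (j + v + 2) * (w - 1) * ratio-num N j v w
    + p * (j + w + 1) * (j + v + 1) * m * (m - 1) * ratio-den N j v w
  ≡ (m - 1) * (r₁ * ratio-num N j v w + r₀ * ratio-den N j v w)
{-# INLINE Certificate #-}

certificate : ∀ n j v →
  Certificate (Q n j) (P n j) (R n j v) (R n j (v + 1)) (2 * n) (2 * n - 2 * j) j v (2 * n - 2 * j - v)
certificate = solve-∀ ℚ-ring

certificate-at : ∀ {n j v N m w} → N ≡ 2 * n → m ≡ 2 * n - 2 * j → w ≡ 2 * n - 2 * j - v →
                 Certificate (Q n j) (P n j) (R n j v) (R n j (v + 1)) N m j v w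
certificate-at {n} {j} {v} refl refl refl = certificate n j v

creative-telescoping : ∀ {q p r₀ r₁ N m m₂ j v w w₂ s x x′ y t₀ t₁ g₀ g₁ : ℚ} →
  Certificate q p r₀ r₁ N m j v w →
  m₂ ≡ m * (m - 1) → w₂ ≡ w * (w - 1) → m₂ * ratio-den N j v w ≢ 0ℚ →
  ratio-den N j v w * x′ ≡ ratio-num N j v w * x →
  m₂ * (j + v + 1) * (N + (j + w)) * y ≡ (j + w) * (j + v + 2) * w₂ * ((N + (j + v) + 1) * (j + w)) * x →
  t₀ ≡ s * ((j + w + 1) * (j + v + 1) * x) → t₁ ≡ - (s * y) →
  g₀ ≡ r₀ * (s * x) → g₁ ≡ - (r₁ * (s * x′)) →
  m * (q * t₁ - p * t₀) ≡ g₁ - g₀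
creative-telescoping {q} {p} {r₀} {r₁} {N} {m} {j = j} {v} {w} {s = s} {x} {x′} {y}
                     cert refl refl Δ≢0 x-shift y-lower refl refl refl refl =
  let num    = ratio-num N j v w
      den    = ratio-den N j v w
      p-part = p * (j + w + 1) * (j + v + 1) * m * (m - 1) * den
  in *-cancelˡ-≢0 _ Δ≢0 (begin
  m * (m - 1) * den * (m * (q * - (s * y) - p * (s * ((j + w + 1) * (j + v + 1) * x))))
    ≡⟨ solve (q ∷ p ∷ N ∷ m ∷ j ∷ v ∷ w ∷ s ∷ x ∷ y ∷ []) ℚ-ring ⟩
  - (m * q * s * (v + 1)) * (m * (m - 1) * (j + v + 1) * (N + (j + w)) * y) - m * s * x * p-part
    ≡⟨ cong (λ z → - (m * q * s * (v + 1)) * z - m * s * x * p-part) y-lower ⟩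
  - (m * q * s * (v + 1)) * ((j + w) * (j + v + 2) * (w * (w - 1)) * ((N + (j + v) + 1) * (j + w)) * x)
    - m * s * x * p-part
    ≡⟨ solve (q ∷ p ∷ N ∷ m ∷ j ∷ v ∷ w ∷ s ∷ x ∷ []) ℚ-ring ⟩
  - (m * s * x) * (q * (v + 1) * (j + w) * (j + v + 2) * (w - 1) * num + p-part)
    ≡⟨ cong (λ z → - (m * s * x) * z) cert ⟩
  - (m * s * x) * ((m - 1) * (r₁ * num + r₀ * den))
    ≡⟨ solve (r₀ ∷ r₁ ∷ N ∷ m ∷ j ∷ v ∷ w ∷ s ∷ x ∷ []) ℚ-ring ⟩
  - (m * (m - 1) * r₁ * s) * (num * x) - m * (m - 1) * den * (r₀ * (s * x))
    ≡⟨ cong (λ z → - (m * (m - 1) * r₁ * s) * z - m * (m - 1) * den * (r₀ * (s * x))) x-shift ⟨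
  - (m * (m - 1) * r₁ * s) * (den * x′) - m * (m - 1) * den * (r₀ * (s * x))
    ≡⟨ solve (r₀ ∷ r₁ ∷ N ∷ m ∷ j ∷ v ∷ w ∷ s ∷ x ∷ x′ ∷ []) ℚ-ring ⟩
  m * (m - 1) * den * (- (r₁ * (s * x′)) - r₀ * (s * x))
    ∎)
  where open ≡-Reasoning

-- The recurrence for the sum

S : ℕ → ℕ → ℚ
S n i = sumTo (2 ℕ.* n ∸ 2 ℕ.* i) (λ v → binom (2 ℕ.* n ∸ 2 ℕ.* i) v * F n (i ℕ.+ v))

module SumRecurrence (j a : ℕ) where

  n N m : ℕ
  n = j ℕ.+ suc a
  N = 2 ℕ.* n
  m = suc (suc (a ℕ.+ a))

  ν J : ℚ
  ν = ℕ→ℚ n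
  J = ℕ→ℚ j

  [2n∸2j]≡m : 2 ℕ.* n ∸ 2 ℕ.* j ≡ m
  [2n∸2j]≡m = trans (cong (_∸ 2 ℕ.* j) (expand j a)) (ℕP.m+n∸m≡n (2 ℕ.* j) m)
    where
    expand : ∀ j a → 2 ℕ.* (j ℕ.+ suc a) ≡ 2 ℕ.* j ℕ.+ suc (suc (a ℕ.+ a))
    expand = solveℕ

  [2n∸2[j+1]]≡a+a : 2 ℕ.* n ∸ 2 ℕ.* suc j ≡ a ℕ.+ a
  [2n∸2[j+1]]≡a+a = trans (cong (_∸ 2 ℕ.* suc j) (expand j a)) (ℕP.m+n∸m≡n (2 ℕ.* suc j) (a ℕ.+ a))
    where
    expand : ∀ j a → 2 ℕ.* (j ℕ.+ suc a) ≡ 2 ℕ.* suc j ℕ.+ (a ℕ.+ a)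
    expand = solveℕ

  v+w≡m⇒[j+v]+[j+w]≡N : ∀ {v w} → v ℕ.+ w ≡ m → (j ℕ.+ v) ℕ.+ (j ℕ.+ w) ≡ N
  v+w≡m⇒[j+v]+[j+w]≡N {v} {w} v+w≡m = trans (regroup j v w) (trans (cong (j ℕ.+ j ℕ.+_) v+w≡m) (expand j a))
    where
    regroup : ∀ j v w → (j ℕ.+ v) ℕ.+ (j ℕ.+ w) ≡ j ℕ.+ j ℕ.+ (v ℕ.+ w)
    regroup = solveℕ
    expand : ∀ j a → j ℕ.+ j ℕ.+ suc (suc (a ℕ.+ a)) ≡ 2 ℕ.* (j ℕ.+ suc a)
    expand = solveℕ

  0<N : 0 < N
  0<N = ℕP.<-≤-trans (subst (0 <_) (sym (ℕP.+-suc j a)) (s≤s z≤n)) (ℕP.m≤m+n n (n ℕ.+ 0))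

  t₀ t₁ s : ℕ → ℚ
  t₀ v = binom m v * F n (j ℕ.+ v)
  t₁ v = binom (a ℕ.+ a) v * F n (suc j ℕ.+ v)
  s v = sgn (j ℕ.+ v) * (inv-suc N * inv-suc N)

  lowered : ℕ → ℕ
  lowered v = ((a ℕ.+ a) C v) ℕ.* Fnum N (suc (j ℕ.+ v))

  G : ℕ → ℚ
  G v = R ν J (ℕ→ℚ v) * (s v * ℕ→ℚ (kernel N m j v))

  module AtIndex (v : ℕ) (v≤m : v ≤ m) where

    w : ℕ
    w = m ∸ v

    v+w≡m : v ℕ.+ w ≡ m
    v+w≡m = ℕP.m+[n∸m]≡n v≤m

    V W N′ M : ℚ
    V  = ℕ→ℚ v
    W  = ℕ→ℚ w
    N′ = ℕ→ℚ N
    M  = ℕ→ℚ m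

    M≡2ν-2J : M ≡ 2 * ν - 2 * J
    M≡2ν-2J = begin
      M                          ≡⟨ ℕ→ℚ-homo-⟦⟧ (1+ 1+ (⌜ a ⌝ :+ ⌜ a ⌝)) ⟩
      1 + (1 + (A + A))          ≡⟨ expand J A ⟩
      2 * (J + (1 + A)) - 2 * J  ≡⟨ cong (λ z → 2 * z - 2 * J) (ℕ→ℚ-homo-⟦⟧ (⌜ j ⌝ :+ 1+ ⌜ a ⌝)) ⟨
      2 * ν - 2 * J              ∎
      where
      open ≡-Reasoning
      A : ℚ
      A = ℕ→ℚ a
      expand : ∀ J A → 1 + (1 + (A + A)) ≡ 2 * (J + (1 + A)) - 2 * J
      expand = solve-∀ ℚ-ring

    W≡2ν-2J-V : W ≡ 2 * ν - 2 * J - V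
    W≡2ν-2J-V = begin
      W                  ≡⟨ cancel V W ⟩
      V + W - V          ≡⟨ cong (_- V) (trans (sym (ℕ→ℚ-homo-+ v w)) (cong ℕ→ℚ v+w≡m)) ⟩
      M - V              ≡⟨ cong (_- V) M≡2ν-2J ⟩
      2 * ν - 2 * J - V  ∎
      where
      open ≡-Reasoning
      cancel : ∀ V W → W ≡ V + W - V
      cancel = solve-∀ ℚ-ring

    cert : Certificate (Q ν J) (P ν J) (R ν J V) (R ν J (V + 1)) N′ M J V W
    cert = certificate-at {ν} {J} {V} (ℕ→ℚ-homo-⟦⟧ (⌜ 2 ⌝ :* ⌜ n ⌝)) M≡2ν-2J W≡2ν-2J-V

    denominator≢0 : ℕ→ℚ (m ℕ.* (m ∸ 1)) * ratio-den N′ J V W ≢ 0ℚ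
    denominator≢0 = subst (_≢ 0ℚ) (ℕ→ℚ-homo-⟦⟧ Δ) (0<n⇒ℕ→ℚ[n]≢0 {⟦ Δ ⟧ℕ}
      (m>0∧n>0⇒m*n>0 {m ℕ.* (m ∸ 1)} (s≤s z≤n)
        (m>0∧n>0⇒m*n>0 (m>0∧n>0⇒m*n>0 (ℕP.m≤n+m 1 v) (ℕP.m≤n+m 1 (j ℕ.+ v)))
                       (ℕP.<-≤-trans 0<N (ℕP.m≤m+n N (j ℕ.+ w))))))
      where
      Δ : Expr
      Δ = ⌜ m ℕ.* (m ∸ 1) ⌝ :* ((⌜ v ⌝ :+ ⌜ 1 ⌝) :* (⌜ j ⌝ :+ ⌜ v ⌝ :+ ⌜ 1 ⌝) :* (⌜ N ⌝ :+ (⌜ j ⌝ :+ ⌜ w ⌝)))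

    kernel-shiftℚ : ratio-den N′ J V W * ℕ→ℚ (kernel N m j (suc v)) ≡ ratio-num N′ J V W * ℕ→ℚ (kernel N m j v)
    kernel-shiftℚ =
      ⟦⟧ℕ≡⇒⟦⟧ℚ≡ ((⌜ v ⌝ :+ ⌜ 1 ⌝) :* (⌜ j ⌝ :+ ⌜ v ⌝ :+ ⌜ 1 ⌝) :* (⌜ N ⌝ :+ (⌜ j ⌝ :+ ⌜ w ⌝)) :* ⌜ kernel N m j (suc v) ⌝)
                (⌜ w ⌝ :* (⌜ N ⌝ :+ (⌜ j ⌝ :+ ⌜ v ⌝) :+ ⌜ 1 ⌝) :* (⌜ j ⌝ :+ ⌜ w ⌝) :* ⌜ kernel N m j v ⌝)
                (kernel-shift {N} {m} {j} {v} {w} v+w≡m (v+w≡m⇒[j+v]+[j+w]≡N v+w≡m))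

    kernel-lowerℚ : ℕ→ℚ (m ℕ.* (m ∸ 1)) * (J + V + 1) * (N′ + (J + W)) * ℕ→ℚ (lowered v)
                    ≡ (J + W) * (J + V + 2) * ℕ→ℚ (w ℕ.* (w ∸ 1)) * ((N′ + (J + V) + 1) * (J + W)) * ℕ→ℚ (kernel N m j v)
    kernel-lowerℚ =
      ⟦⟧ℕ≡⇒⟦⟧ℚ≡ (⌜ m ℕ.* (m ∸ 1) ⌝ :* (⌜ j ⌝ :+ ⌜ v ⌝ :+ ⌜ 1 ⌝) :* (⌜ N ⌝ :+ (⌜ j ⌝ :+ ⌜ w ⌝)) :* ⌜ lowered v ⌝)
                ((⌜ j ⌝ :+ ⌜ w ⌝) :* (⌜ j ⌝ :+ ⌜ v ⌝ :+ ⌜ 2 ⌝) :* ⌜ w ℕ.* (w ∸ 1) ⌝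
                   :* ((⌜ N ⌝ :+ (⌜ j ⌝ :+ ⌜ v ⌝) :+ ⌜ 1 ⌝) :* (⌜ j ⌝ :+ ⌜ w ⌝)) :* ⌜ kernel N m j v ⌝)
                (kernel-lower {N} {a ℕ.+ a} {j} {v} {w} v+w≡m (v+w≡m⇒[j+v]+[j+w]≡N v+w≡m))

    t₀≡ : t₀ v ≡ s v * ((J + W + 1) * (J + V + 1) * ℕ→ℚ (kernel N m j v))
    t₀≡ = trans (binom*F≡sgn*Fnum n m v (j ℕ.+ v) (λ _ → j+v≤N))
                (cong (s v *_) (trans (cong ℕ→ℚ (kernel-Fnum {N} {m} {j} {v} {w} (v+w≡m⇒[j+v]+[j+w]≡N v+w≡m)))
                                      (ℕ→ℚ-homo-⟦⟧ ((⌜ j ⌝ :+ ⌜ w ⌝ :+ ⌜ 1 ⌝) :* (⌜ j ⌝ :+ ⌜ v ⌝ :+ ⌜ 1 ⌝)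
                                                     :* ⌜ kernel N m j v ⌝))))
      where
      j+v≤N : j ℕ.+ v ≤ N
      j+v≤N = subst (j ℕ.+ v ≤_) (v+w≡m⇒[j+v]+[j+w]≡N v+w≡m) (ℕP.m≤m+n (j ℕ.+ v) (j ℕ.+ w))

    t₁≡ : t₁ v ≡ - (s v * ℕ→ℚ (lowered v))
    t₁≡ = trans (binom*F≡sgn*Fnum n (a ℕ.+ a) v (suc j ℕ.+ v) bound)
                (neg-assoc (sgn (j ℕ.+ v)) (inv-suc N * inv-suc N) (ℕ→ℚ (lowered v)))
      where
      bound : v ≤ a ℕ.+ a → suc j ℕ.+ v ≤ N
      bound v≤2a = ℕP.≤-trans (ℕP.+-monoʳ-≤ (suc j) v≤2a)
                     (subst (suc j ℕ.+ (a ℕ.+ a) ≤_) (expand j a) (ℕP.m≤m+n (suc j ℕ.+ (a ℕ.+ a)) (suc j)))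
        where
        expand : ∀ j a → suc j ℕ.+ (a ℕ.+ a) ℕ.+ suc j ≡ 2 ℕ.* (j ℕ.+ suc a)
        expand = solveℕ
      neg-assoc : ∀ a b c → - a * b * c ≡ - (a * b * c)
      neg-assoc = solve-∀ ℚ-ring

    G[v+1]≡ : G (suc v) ≡ - (R ν J (V + 1) * (s v * ℕ→ℚ (kernel N m j (suc v))))
    G[v+1]≡ =
      trans (cong₂ (λ r k → R ν J r * (sgn k * (inv-suc N * inv-suc N) * ℕ→ℚ (kernel N m j (suc v))))
                   (ℕ→ℚ-suc v) (ℕP.+-suc j v))
            (neg-assoc (R ν J (V + 1)) (sgn (j ℕ.+ v)) (inv-suc N * inv-suc N) (ℕ→ℚ (kernel N m j (suc v))))
      where
      neg-assoc : ∀ r a b c → r * (- a * b * c) ≡ - (r * (a * b * c))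
      neg-assoc = solve-∀ ℚ-ring

  telescoping-step : ∀ v → v ≤ m → ℕ→ℚ m * (Q ν J * t₁ v - P ν J * t₀ v) ≡ G (suc v) - G v
  telescoping-step v v≤m =
    creative-telescoping {Q ν J} {P ν J} {R ν J V} {R ν J (V + 1)} {N′} {M} {j = J} {V} {W}
                         {s = s v} {ℕ→ℚ (kernel N m j v)} {ℕ→ℚ (kernel N m j (suc v))} {ℕ→ℚ (lowered v)}
      cert (ℕ→ℚ-n*[n∸1] m) (ℕ→ℚ-n*[n∸1] w) denominator≢0 kernel-shiftℚ kernel-lowerℚ t₀≡ t₁≡ refl G[v+1]≡
    where open AtIndex v v≤m

  S-recurrence : Q ν J * S n (suc j) ≡ P ν J * S n j
  S-recurrence = x∙y⁻¹≈ε⇒x≈y (Q ν J * S n (suc j)) (P ν J * S n j)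
    (*-cancelˡ-≢0 (ℕ→ℚ m) (0<n⇒ℕ→ℚ[n]≢0 {m} (s≤s z≤n)) (trans (begin
      ℕ→ℚ m * (Q ν J * S n (suc j) - P ν J * S n j)
        ≡⟨ cong₂ (λ x y → ℕ→ℚ m * (Q ν J * x - P ν J * y)) S[j+1]≡ S[j]≡ ⟩
      ℕ→ℚ m * (Q ν J * sumTo m t₁ - P ν J * sumTo m t₀)
        ≡⟨ distribute (ℕ→ℚ m) (Q ν J) (P ν J) (sumTo m t₁) (sumTo m t₀) ⟩
      ℕ→ℚ m * Q ν J * sumTo m t₁ + - (ℕ→ℚ m * P ν J) * sumTo m t₀
        ≡⟨ sumTo-linear m (ℕ→ℚ m * Q ν J) (- (ℕ→ℚ m * P ν J)) t₁ t₀ ⟨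
      sumTo m (λ v → ℕ→ℚ m * Q ν J * t₁ v + - (ℕ→ℚ m * P ν J) * t₀ v)
        ≡⟨ sumTo-cong m (λ v v≤m → trans (sym (distribute (ℕ→ℚ m) (Q ν J) (P ν J) (t₁ v) (t₀ v)))
                                         (telescoping-step v v≤m)) ⟩
      sumTo m (λ v → G (suc v) - G v)
        ≡⟨ sumTo-telescoping m G ⟩
      G (suc m) - G 0
        ≡⟨ cong₂ _-_ G[m+1]≡0 G[0]≡0 ⟩
      0ℚ ∎) (sym (ℚP.*-zeroʳ (ℕ→ℚ m)))))
    where
    open ≡-Reasoning
    distribute : ∀ μ q p x y → μ * (q * x - p * y) ≡ μ * q * x + - (μ * p) * y
    distribute = solve-∀ ℚ-ring
    S[j+1]≡ : S n (suc j) ≡ sumTo m t₁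
    S[j+1]≡ = trans (cong (λ L → sumTo L (λ v → binom L v * F n (suc j ℕ.+ v))) [2n∸2[j+1]]≡a+a)
                    (sym (sumTo-vanishing-tail 2 (a ℕ.+ a) t₁ λ v a+a<v →
                       trans (cong (λ z → ℕ→ℚ z * F n (suc j ℕ.+ v)) (k>n⇒nCk≡0 a+a<v))
                             (ℚP.*-zeroˡ (F n (suc j ℕ.+ v)))))
    S[j]≡ : S n j ≡ sumTo m t₀
    S[j]≡ = cong (λ L → sumTo L (λ v → binom L v * F n (j ℕ.+ v))) [2n∸2j]≡m
    G[m+1]≡0 : G (suc m) ≡ 0ℚ
    G[m+1]≡0 = trans (cong (λ z → R ν J (ℕ→ℚ (suc m)) * (s (suc m) * ℕ→ℚ (z ℕ.* Fbin N (j ℕ.+ suc m))))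
                           (k>n⇒nCk≡0 (ℕP.n<1+n m)))
                     (trans (cong (R ν J (ℕ→ℚ (suc m)) *_) (ℚP.*-zeroʳ (s (suc m))))
                            (ℚP.*-zeroʳ (R ν J (ℕ→ℚ (suc m)))))
    G[0]≡0 : G 0 ≡ 0ℚ
    G[0]≡0 = trans (cong (_* (s 0 * ℕ→ℚ (kernel N m j 0))) (R[n,j,0]≡0 ν J))
                   (ℚP.*-zeroˡ (s 0 * ℕ→ℚ (kernel N m j 0)))

-- The closed form

L≡ : ∀ n i → ((+ (2 ℕ.* n ℕ.* n ℕ.+ n ℕ.+ 1)) ℤ.- (+ i) ℤ.* ((+ n) ℤ.- + 1)) ℚ./ 1 ≡ L (ℕ→ℚ n) (ℕ→ℚ i)
L≡ n i = begin
  (+ X ℤ.- + i ℤ.* (+ n ℤ.- + 1)) ℚ./ 1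
    ≡⟨ ℚP.↥p/↧p≡p (fromℤ (+ X ℤ.- + i ℤ.* (+ n ℤ.- + 1))) ⟩
  fromℤ (+ X ℤ.- + i ℤ.* (+ n ℤ.- + 1))
    ≡⟨ fromℤ-homo-minus (+ X) (+ i ℤ.* (+ n ℤ.- + 1)) ⟩
  fromℤ (+ X) - fromℤ (+ i ℤ.* (+ n ℤ.- + 1))
    ≡⟨ cong₂ _-_ (sym (ℕ→ℚ≡fromℤ X))
                 (trans (fromℤ-homo-* (+ i) (+ n ℤ.- + 1))
                        (cong₂ _*_ (sym (ℕ→ℚ≡fromℤ i)) (fromℤ-homo-minus (+ n) (+ 1)))) ⟩
  ℕ→ℚ X - ℕ→ℚ i * (fromℤ (+ n) - 1)
    ≡⟨ cong₂ (λ x y → x - ℕ→ℚ i * (y - 1)) (ℕ→ℚ-homo-⟦⟧ (⌜ 2 ⌝ :* ⌜ n ⌝ :* ⌜ n ⌝ :+ ⌜ n ⌝ :+ ⌜ 1 ⌝))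
                                           (sym (ℕ→ℚ≡fromℤ n)) ⟩
  2 * ℕ→ℚ n * ℕ→ℚ n + ℕ→ℚ n + 1 - ℕ→ℚ i * (ℕ→ℚ n - 1)
    ≡⟨ square (ℕ→ℚ n) (ℕ→ℚ i) ⟩
  L (ℕ→ℚ n) (ℕ→ℚ i)
    ∎
  where
  open ≡-Reasoning
  X : ℕ
  X = 2 ℕ.* n ℕ.* n ℕ.+ n ℕ.+ 1
  square : ∀ n i → 2 * n * n + n + 1 - i * (n - 1) ≡ L n i
  square = solve-∀ ℚ-ring

RHS≡ : ∀ n i → RHS n i ≡ sgn n * FussCat3 n
                          * (binom (2 ℕ.* n ℕ.+ i) i * binom (2 ℕ.* n ℕ.+ 1) (n ℕ.+ i ℕ.+ 1) * inv-suc (2 ℕ.* n))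
                          * L (ℕ→ℚ n) (ℕ→ℚ i)
RHS≡ n i = cong₂ (λ x y → sgn n * FussCat3 n * x * y)
  (trans (/suc≡*inv-suc (c₁ ℕ.* c₂) (2 ℕ.* n)) (cong (_* inv-suc (2 ℕ.* n)) (ℕ→ℚ-homo-* c₁ c₂)))
  (L≡ n i)
  where
  c₁ c₂ : ℕ
  c₁ = (2 ℕ.* n ℕ.+ i) C i
  c₂ = (2 ℕ.* n ℕ.+ 1) C (n ℕ.+ i ℕ.+ 1)

FussCat3≡ : ∀ n → FussCat3 n ≡ binom (2 ℕ.* n ℕ.+ n) n * inv-suc (2 ℕ.* n)
FussCat3≡ n =
  trans (/suc≡*inv-suc ((3 ℕ.* n) C n) (2 ℕ.* n)) (cong (λ x → ℕ→ℚ (x C n) * inv-suc (2 ℕ.* n)) (expand n))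
  where
  expand : ∀ n → 3 ℕ.* n ≡ 2 ℕ.* n ℕ.+ n
  expand = solveℕ

MS[n,n]≡RHS[n,n] : ∀ n → MS n n ≡ RHS n n
MS[n,n]≡RHS[n,n] n = begin
  binom (N ∸ n) n * sumTo (N ∸ N) (λ v → binom (N ∸ N) v * F n (n ℕ.+ v))
    ≡⟨ cong₂ (λ x y → binom x n * sumTo y (λ v → binom y v * F n (n ℕ.+ v))) N∸n≡n (ℕP.n∸n≡0 N) ⟩
  binom n n * (binom 0 0 * F n (n ℕ.+ 0))
    ≡⟨ cong₂ (λ x y → ℕ→ℚ x * (1ℚ * F n y)) (nCn≡1 n) (ℕP.+-identityʳ n) ⟩
  1ℚ * (1ℚ * F n n)
    ≡⟨ cong (λ x → 1ℚ * (1ℚ * x)) (F≡sgn*Fnum n n (ℕP.m≤m+n n (n ℕ.+ 0))) ⟩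
  1ℚ * (1ℚ * (sgn n * (K * K) * ℕ→ℚ (Fnum N n)))
    ≡⟨ cong (λ x → 1ℚ * (1ℚ * (sgn n * (K * K) * x))) (trans (cong ℕ→ℚ Fnum≡) (ℕ→ℚ-homo-⟦⟧ E)) ⟩
  1ℚ * (1ℚ * (sgn n * (K * K) * ((ν + 1) * (ν + 1) * (ℕ→ℚ c * ℕ→ℚ c))))
    ≡⟨ square (sgn n) K (ℕ→ℚ c) ν ⟩
  sgn n * (ℕ→ℚ c * K) * (ℕ→ℚ c * 1ℚ * K) * L ν ν
    ≡⟨ cong₂ (λ x y → sgn n * (ℕ→ℚ x * K) * (ℕ→ℚ c * ℕ→ℚ y * K) * L ν ν) c-sym top≡1 ⟨
  sgn n * (binom (N ℕ.+ n) n * K) * (ℕ→ℚ c * binom (N ℕ.+ 1) (n ℕ.+ n ℕ.+ 1) * K) * L ν ν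
    ≡⟨ cong₂ (λ x y → sgn n * x * (ℕ→ℚ y * binom (N ℕ.+ 1) (n ℕ.+ n ℕ.+ 1) * K) * L ν ν) (FussCat3≡ n) c-sym ⟨
  sgn n * FussCat3 n * (binom (N ℕ.+ n) n * binom (N ℕ.+ 1) (n ℕ.+ n ℕ.+ 1) * K) * L ν ν
    ≡⟨ RHS≡ n n ⟨
  RHS n n
    ∎
  where
  open ≡-Reasoning
  N c : ℕ
  N = 2 ℕ.* n
  c = (N ℕ.+ n) C N
  K ν : ℚ
  K = inv-suc N
  ν = ℕ→ℚ n
  E : Expr
  E = (⌜ n ⌝ :+ ⌜ 1 ⌝) :* (⌜ n ⌝ :+ ⌜ 1 ⌝) :* (⌜ c ⌝ :* ⌜ c ⌝)
  n+n≡N : n ℕ.+ n ≡ N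
  n+n≡N = cong (n ℕ.+_) (sym (ℕP.+-identityʳ n))
  N∸n≡n : N ∸ n ≡ n
  N∸n≡n = trans (cong (_∸ n) (sym n+n≡N)) (ℕP.m+n∸m≡n n n)
  Fnum≡ : Fnum N n ≡ ⟦ E ⟧ℕ
  Fnum≡ = trans (Fnum-split {N} {n} {n} n+n≡N) (cong ((n ℕ.+ 1) ℕ.* (n ℕ.+ 1) ℕ.*_) (Fbin-split {N} {n} {n} n+n≡N))
  c-sym : (N ℕ.+ n) C n ≡ c
  c-sym = trans (nCk≡nC[n∸k] (ℕP.m≤n+m n N)) (cong ((N ℕ.+ n) C_) (ℕP.m+n∸n≡m N n))
  top≡1 : (N ℕ.+ 1) C (n ℕ.+ n ℕ.+ 1) ≡ 1
  top≡1 = trans (cong (λ x → (N ℕ.+ 1) C (x ℕ.+ 1)) n+n≡N) (nCn≡1 (N ℕ.+ 1))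
  square : ∀ s K c ν → 1ℚ * (1ℚ * (s * (K * K) * ((ν + 1) * (ν + 1) * (c * c))))
                       ≡ s * (c * K) * (c * 1ℚ * K) * L ν ν
  square = solve-∀ ℚ-ring

ClosedFormRatio : (ν J A q p l₀ l₁ : ℚ) → Set
ClosedFormRatio ν J A q p l₀ l₁ =
  (1 + (J + (1 + (A + A)))) * (1 + (2 * ν + J)) * (1 + A) * q * l₁
    ≡ (1 + (A + A)) * (1 + (1 + (A + A))) * (1 + (ν + J + 1)) * p * l₀
{-# INLINE ClosedFormRatio #-}

closed-form-identity : ∀ J A → let ν = J + (1 + A) in ClosedFormRatio ν J A (Q ν J) (P ν J) (L ν J) (L ν (J + 1))
closed-form-identity = solve-∀ ℚ-ring

P-expanded : ∀ J A → P (J + (1 + A)) J ≡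
  (1 + (1 + (1 + (3 * J + 2 * A)))) * (1 + (1 + (J + 2 * A)))
    * (1 + (1 + (1 + (1 + (J * J + 2 * A * A + 3 * J * A + 4 * J + 4 * A)))))
P-expanded = solve-∀ ℚ-ring

closed-form-ratio : ∀ {ν J A q p l₀ l₁ σ K x₀ b₀ b₁ C₀ C₁ D₀ D₁ : ℚ} →
  (1 + (1 + (A + A))) * (1 + J) * (1 + (ν + J + 1)) ≢ 0ℚ → ClosedFormRatio ν J A q p l₀ l₁ →
  (1 + (1 + (A + A))) * b₀ ≡ (1 + (J + (1 + (A + A)))) * x₀ →
  (1 + J) * b₁ ≡ (1 + (A + A)) * x₀ →
  (1 + J) * C₁ ≡ (1 + (2 * ν + J)) * C₀ →
  (1 + (ν + J + 1)) * D₁ ≡ (1 + A) * D₀ →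
  b₀ * q * (σ * (C₁ * D₁ * K) * l₁) ≡ p * (σ * (C₀ * D₀ * K) * l₀) * b₁
closed-form-ratio {ν} {J} {A} {q} {p} {l₀} {l₁} {σ} {K} {x₀} {b₀} {b₁} {C₀} {C₁} {D₀} {D₁}
                  Z≢0 identity eb₀ eb₁ eC eD = *-cancelˡ-≢0 _ Z≢0 (begin
  (1 + (1 + (A + A))) * (1 + J) * (1 + (ν + J + 1)) * (b₀ * q * (σ * (C₁ * D₁ * K) * l₁))
    ≡⟨ solve (ν ∷ J ∷ A ∷ q ∷ l₁ ∷ σ ∷ K ∷ b₀ ∷ C₁ ∷ D₁ ∷ []) ℚ-ring ⟩
  ((1 + (1 + (A + A))) * b₀) * ((1 + J) * C₁) * ((1 + (ν + J + 1)) * D₁) * (q * σ * K * l₁)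
    ≡⟨ cong₂ (λ x y → x * y * (q * σ * K * l₁)) (cong₂ _*_ eb₀ eC) eD ⟩
  ((1 + (J + (1 + (A + A)))) * x₀) * ((1 + (2 * ν + J)) * C₀) * ((1 + A) * D₀) * (q * σ * K * l₁)
    ≡⟨ solve (ν ∷ J ∷ A ∷ q ∷ l₁ ∷ σ ∷ K ∷ x₀ ∷ C₀ ∷ D₀ ∷ []) ℚ-ring ⟩
  (x₀ * C₀ * D₀ * σ * K) * ((1 + (J + (1 + (A + A)))) * (1 + (2 * ν + J)) * (1 + A) * q * l₁)
    ≡⟨ cong ((x₀ * C₀ * D₀ * σ * K) *_) identity ⟩
  (x₀ * C₀ * D₀ * σ * K) * ((1 + (A + A)) * (1 + (1 + (A + A))) * (1 + (ν + J + 1)) * p * l₀)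
    ≡⟨ solve (ν ∷ J ∷ A ∷ p ∷ l₀ ∷ σ ∷ K ∷ x₀ ∷ C₀ ∷ D₀ ∷ []) ℚ-ring ⟩
  ((1 + (A + A)) * x₀) * ((1 + (1 + (A + A))) * (1 + (ν + J + 1)) * (p * (σ * (C₀ * D₀ * K) * l₀)))
    ≡⟨ cong (_* ((1 + (1 + (A + A))) * (1 + (ν + J + 1)) * (p * (σ * (C₀ * D₀ * K) * l₀)))) eb₁ ⟨
  ((1 + J) * b₁) * ((1 + (1 + (A + A))) * (1 + (ν + J + 1)) * (p * (σ * (C₀ * D₀ * K) * l₀)))
    ≡⟨ solve (ν ∷ J ∷ A ∷ p ∷ l₀ ∷ σ ∷ K ∷ b₁ ∷ C₀ ∷ D₀ ∷ []) ℚ-ring ⟩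
  (1 + (1 + (A + A))) * (1 + J) * (1 + (ν + J + 1)) * (p * (σ * (C₀ * D₀ * K) * l₀) * b₁)
    ∎)
  where open ≡-Reasoning

-- Downward induction

transfer-downward : ∀ {b₀ b₁ s₀ s₁ r₀ r₁ q p : ℚ} → b₁ ≢ 0ℚ → p ≢ 0ℚ →
  q * s₁ ≡ p * s₀ → b₀ * q * r₁ ≡ p * r₀ * b₁ → b₁ * s₁ ≡ r₁ → b₀ * s₀ ≡ r₀
transfer-downward {b₀} {b₁} {s₀} {s₁} {r₀} {r₁} {q} {p} b₁≢0 p≢0 recurrence ratio agree =
  *-cancelˡ-≢0 p p≢0 (*-cancelˡ-≢0 b₁ b₁≢0 (begin
  b₁ * (p * (b₀ * s₀))  ≡⟨ solve (b₀ ∷ b₁ ∷ s₀ ∷ p ∷ []) ℚ-ring ⟩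
  b₀ * b₁ * (p * s₀)    ≡⟨ cong (b₀ * b₁ *_) recurrence ⟨
  b₀ * b₁ * (q * s₁)    ≡⟨ solve (b₀ ∷ b₁ ∷ s₁ ∷ q ∷ []) ℚ-ring ⟩
  b₀ * q * (b₁ * s₁)    ≡⟨ cong (b₀ * q *_) agree ⟩
  b₀ * q * r₁           ≡⟨ ratio ⟩
  p * r₀ * b₁           ≡⟨ solve (b₁ ∷ r₀ ∷ p ∷ []) ℚ-ring ⟩
  b₁ * (p * r₀)         ∎))
  where open ≡-Reasoning

module DownwardStep (j a : ℕ) where

  open SumRecurrence j a using (n; N; ν; J; S-recurrence)

  A : ℚ
  A = ℕ→ℚ a

  ν≡J+1+A : ν ≡ J + (1 + A)
  ν≡J+1+A = ℕ→ℚ-homo-⟦⟧ (⌜ j ⌝ :+ 1+ ⌜ a ⌝)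

  N∸j≡ : N ∸ j ≡ suc (j ℕ.+ suc (a ℕ.+ a))
  N∸j≡ = trans (cong (_∸ j) (expand j a)) (ℕP.m+n∸m≡n j _)
    where
    expand : ∀ j a → 2 ℕ.* (j ℕ.+ suc a) ≡ j ℕ.+ suc (j ℕ.+ suc (a ℕ.+ a))
    expand = solveℕ

  N∸[j+1]≡ : N ∸ suc j ≡ j ℕ.+ suc (a ℕ.+ a)
  N∸[j+1]≡ = trans (cong (_∸ suc j) (expand j a)) (ℕP.m+n∸m≡n (suc j) _)
    where
    expand : ∀ j a → 2 ℕ.* (j ℕ.+ suc a) ≡ suc j ℕ.+ (j ℕ.+ suc (a ℕ.+ a))
    expand = solveℕ

  RHS-ratio : binom (N ∸ j) j * Q ν J * RHS n (suc j) ≡ P ν J * RHS n j * binom (N ∸ suc j) (suc j)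
  RHS-ratio = begin
    binom (N ∸ j) j * Q ν J * RHS n (suc j)
      ≡⟨ cong (binom (N ∸ j) j * Q ν J *_)
              (trans (RHS≡ n (suc j)) (cong (λ z → σ * (C₁ * D₁ * K) * L ν z) (ℕ→ℚ-suc j))) ⟩
    binom (N ∸ j) j * Q ν J * (σ * (C₁ * D₁ * K) * L ν (J + 1))
      ≡⟨ closed-form-ratio {ν} {J} {A} {Q ν J} {P ν J} {L ν J} {L ν (J + 1)} {σ} {K} Z≢0 identity eb₀ eb₁ eC eD ⟩
    P ν J * (σ * (C₀ * D₀ * K) * L ν J) * binom (N ∸ suc j) (suc j)
      ≡⟨ cong (λ z → P ν J * z * binom (N ∸ suc j) (suc j)) (RHS≡ n j) ⟨
    P ν J * RHS n j * binom (N ∸ suc j) (suc j)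
      ∎
    where
    open ≡-Reasoning
    x₀ : ℕ
    x₀ = (j ℕ.+ suc (a ℕ.+ a)) C j
    σ K C₀ C₁ D₀ D₁ : ℚ
    σ  = sgn n * FussCat3 n
    K  = inv-suc N
    C₀ = binom (N ℕ.+ j) j
    C₁ = binom (N ℕ.+ suc j) (suc j)
    D₀ = binom (N ℕ.+ 1) (n ℕ.+ j ℕ.+ 1)
    D₁ = binom (N ℕ.+ 1) (n ℕ.+ suc j ℕ.+ 1)
    Z≢0 : (1 + (1 + (A + A))) * (1 + J) * (1 + (ν + J + 1)) ≢ 0ℚ
    Z≢0 = subst (_≢ 0ℚ) (ℕ→ℚ-homo-⟦⟧ Z) (0<n⇒ℕ→ℚ[n]≢0 {⟦ Z ⟧ℕ} (s≤s z≤n))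
      where
      Z : Expr
      Z = 1+ 1+ (⌜ a ⌝ :+ ⌜ a ⌝) :* 1+ ⌜ j ⌝ :* 1+ (⌜ n ⌝ :+ ⌜ j ⌝ :+ ⌜ 1 ⌝)
    identity : ClosedFormRatio ν J A (Q ν J) (P ν J) (L ν J) (L ν (J + 1))
    identity = subst (λ ν → ClosedFormRatio ν J A (Q ν J) (P ν J) (L ν J) (L ν (J + 1)))
                     (sym ν≡J+1+A) (closed-form-identity J A)
    eb₀ : (1 + (1 + (A + A))) * binom (N ∸ j) j ≡ (1 + (J + (1 + (A + A)))) * ℕ→ℚ x₀
    eb₀ = trans (cong (λ z → (1 + (1 + (A + A))) * binom z j) N∸j≡)
                (⟦⟧ℕ≡⇒⟦⟧ℚ≡ (1+ 1+ (⌜ a ⌝ :+ ⌜ a ⌝) :* ⌜ suc (j ℕ.+ suc (a ℕ.+ a)) C j ⌝)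
                           (1+ (⌜ j ⌝ :+ 1+ (⌜ a ⌝ :+ ⌜ a ⌝)) :* ⌜ x₀ ⌝)
                           ([l+1]*[k+l+1]Ck≡[k+l+1]*[k+l]Ck j (suc (a ℕ.+ a))))
    eb₁ : (1 + J) * binom (N ∸ suc j) (suc j) ≡ (1 + (A + A)) * ℕ→ℚ x₀
    eb₁ = trans (cong (λ z → (1 + J) * binom z (suc j)) N∸[j+1]≡)
                (⟦⟧ℕ≡⇒⟦⟧ℚ≡ (1+ ⌜ j ⌝ :* ⌜ (j ℕ.+ suc (a ℕ.+ a)) C suc j ⌝) (1+ (⌜ a ⌝ :+ ⌜ a ⌝) :* ⌜ x₀ ⌝)
                           ([k+1]*[k+l]C[k+1]≡l*[k+l]Ck j (suc (a ℕ.+ a))))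
    eC : (1 + J) * C₁ ≡ (1 + (2 * ν + J)) * C₀
    eC = trans (cong (λ z → (1 + J) * binom z (suc j)) (ℕP.+-suc N j))
               (⟦⟧ℕ≡⇒⟦⟧ℚ≡ (1+ ⌜ j ⌝ :* ⌜ suc (N ℕ.+ j) C suc j ⌝) (1+ (⌜ 2 ⌝ :* ⌜ n ⌝ :+ ⌜ j ⌝) :* ⌜ (N ℕ.+ j) C j ⌝)
                          ([k+1]*[n+1]C[k+1]≡[n+1]*nCk (N ℕ.+ j) j))
    eD : (1 + (ν + J + 1)) * D₁ ≡ (1 + A) * D₀
    eD = subst₂ (λ top k → (1 + (ν + J + 1)) * binom top k ≡ (1 + A) * binom top (n ℕ.+ j ℕ.+ 1)) top≡ k≡
               (⟦⟧ℕ≡⇒⟦⟧ℚ≡ (1+ (⌜ n ⌝ :+ ⌜ j ⌝ :+ ⌜ 1 ⌝) :* ⌜ (n ℕ.+ j ℕ.+ 1 ℕ.+ suc a) C suc (n ℕ.+ j ℕ.+ 1) ⌝)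
                          (1+ ⌜ a ⌝ :* ⌜ (n ℕ.+ j ℕ.+ 1 ℕ.+ suc a) C (n ℕ.+ j ℕ.+ 1) ⌝)
                          ([k+1]*[k+l]C[k+1]≡l*[k+l]Ck (n ℕ.+ j ℕ.+ 1) (suc a)))
      where
      top≡ : n ℕ.+ j ℕ.+ 1 ℕ.+ suc a ≡ N ℕ.+ 1
      top≡ = expand j a
        where
        expand : ∀ j a → (j ℕ.+ suc a) ℕ.+ j ℕ.+ 1 ℕ.+ suc a ≡ 2 ℕ.* (j ℕ.+ suc a) ℕ.+ 1
        expand = solveℕ
      k≡ : suc (n ℕ.+ j ℕ.+ 1) ≡ n ℕ.+ suc j ℕ.+ 1
      k≡ = cong (ℕ._+ 1) (sym (ℕP.+-suc n j))

  P≢0 : P ν J ≢ 0ℚ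
  P≢0 = subst (_≢ 0ℚ) (trans (ℕ→ℚ-homo-⟦⟧ E) (sym (trans (cong (λ z → P z J) ν≡J+1+A) (P-expanded J A))))
              (0<n⇒ℕ→ℚ[n]≢0 {⟦ E ⟧ℕ} (s≤s z≤n))
    where
    E : Expr
    E = 1+ 1+ 1+ (⌜ 3 ⌝ :* ⌜ j ⌝ :+ ⌜ 2 ⌝ :* ⌜ a ⌝) :* 1+ 1+ (⌜ j ⌝ :+ ⌜ 2 ⌝ :* ⌜ a ⌝)
        :* 1+ 1+ 1+ 1+ (⌜ j ⌝ :* ⌜ j ⌝ :+ ⌜ 2 ⌝ :* ⌜ a ⌝ :* ⌜ a ⌝ :+ ⌜ 3 ⌝ :* ⌜ j ⌝ :* ⌜ a ⌝
                        :+ ⌜ 4 ⌝ :* ⌜ j ⌝ :+ ⌜ 4 ⌝ :* ⌜ a ⌝)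

  step : MS n (suc j) ≡ RHS n (suc j) → MS n j ≡ RHS n j
  step = transfer-downward {b₀ = binom (N ∸ j) j} {s₀ = S n j} {s₁ = S n (suc j)}
           (0<n⇒ℕ→ℚ[n]≢0 (k≤n⇒0<nCk j+1≤N∸[j+1])) P≢0 S-recurrence RHS-ratio
    where
    j+1≤N∸[j+1] : suc j ≤ N ∸ suc j
    j+1≤N∸[j+1] = subst (suc j ≤_) (sym (trans N∸[j+1]≡ (ℕP.+-suc j (a ℕ.+ a)))) (s≤s (ℕP.m≤m+n j (a ℕ.+ a)))

MS[j+a,j]≡RHS[j+a,j] : ∀ a j → MS (j ℕ.+ a) j ≡ RHS (j ℕ.+ a) j
MS[j+a,j]≡RHS[j+a,j] zero    j = subst (λ n → MS n j ≡ RHS n j) (sym (ℕP.+-identityʳ j)) (MS[n,n]≡RHS[n,n] j)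
MS[j+a,j]≡RHS[j+a,j] (suc a) j =
  DownwardStep.step j a (subst (λ n → MS n (suc j) ≡ RHS n (suc j)) (sym (ℕP.+-suc j a)) (MS[j+a,j]≡RHS[j+a,j] a (suc j)))

lemma1 : (n j : ℕ) → j ≤ n → MS n j ≡ RHS n j
lemma1 n j j≤n = subst (λ n → MS n j ≡ RHS n j) (ℕP.m+[n∸m]≡n j≤n) (MS[j+a,j]≡RHS[j+a,j] (n ∸ j) j)
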